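{- Let $G$ be a simple connected unicyclic graph with minimum degree $1$ that is 2-walk $(a,b)$-parabolic, and let $G_0$ be the graph obtained from $G$ by deleting all pendant vertices. Then (i) the minimum degree of $G_0$ satisfies $\delta(G_0)\geq 2$; and (ii) $a-b\geq 4$ and $a\geq 5$.
   Context: $d(v)$ denotes the degree of $v$ in $G$ and $s(v)=\sum_{u\in N_G(v)}d(u)$. $G$ is called 2-walk $(a,b)$-parabolic if there is exactly one pair $(a,b)$ with $a$ a positive integer and $b$ a non-negative integer satisfying $a^2-8b>0$ such that $s(v)=-d(v)^2+a\,d(v)-b$ for every vertex $v\in V(G)$. A pendant vertex is a vertex of degree $1$. -}

module Defs where

open import Data.Nat using (ℕ; zero; suc; _+_; _*_; _≤_; _<_; _<ᵇ_; _≟_)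
open import Data.Bool using (Bool; true; false; if_then_else_; _∧_; not)
open import Data.Fin using (Fin; toℕ)
open import Data.List using (List; map; allFin)
open import Data.Nat.ListAction using (sum)
open import Data.Product using (_×_; ∃-syntax)
open import Relation.Binary.PropositionalEquality using (_≡_; _≢_)
open import Relation.Nullary using (does)

record Graph (n : ℕ) : Set where
  field
    adj    : Fin n → Fin n → Bool
    sym    : ∀ u v → adj u v ≡ adj v u
    irrefl : ∀ v → adj v v ≡ false
open Graph public

Σv : {n : ℕ} → (Fin n → ℕ) → ℕ
Σv {n} f = sum (map f (allFin n))

deg : {n : ℕ} → Graph n → Fin n → ℕ
deg G v = Σv (λ u → if adj G v u then 1 else 0)

s : {n : ℕ} → Graph n → Fin n → ℕ
s G v = Σv (λ u → if adj G v u then deg G u else 0)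

edgeCount : {n : ℕ} → Graph n → ℕ
edgeCount G = Σv (λ u → Σv (λ v → if (toℕ u <ᵇ toℕ v) ∧ adj G u v then 1 else 0))

data Reachable {n : ℕ} (G : Graph n) : Fin n → Fin n → Set where
  here : ∀ {v} → Reachable G v v
  step : ∀ {u w v} → adj G u w ≡ true → Reachable G w v → Reachable G u v

Connected : {n : ℕ} → Graph n → Set
Connected {n} G = ∀ (u v : Fin n) → Reachable G u v

-- connected unicyclic graph: connected with |E| = |V|
-- (equivalently, connected and containing exactly one cycle)
ConnectedUnicyclic : {n : ℕ} → Graph n → Set
ConnectedUnicyclic {n} G = Connected G × edgeCount G ≡ n

MinDegreeOne : {n : ℕ} → Graph n → Set
MinDegreeOne {n} G = (∀ (v : Fin n) → 1 ≤ deg G v) × ∃[ v ] deg G v ≡ 1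

Pendant : {n : ℕ} → Graph n → Fin n → Set
Pendant G v = deg G v ≡ 1

-- (a,b) satisfies: a positive, b ≥ 0 (natural), a² - 8b > 0, and
-- s(v) = -d(v)² + a d(v) - b for every v (rearranged into ℕ as
-- s(v) + d(v)² + b = a d(v), which is equivalent over ℤ).
ParabolicPair : {n : ℕ} → Graph n → ℕ → ℕ → Set
ParabolicPair {n} G a b =
  1 ≤ a × 8 * b < a * a ×
  (∀ (v : Fin n) → s G v + deg G v * deg G v + b ≡ a * deg G v)

TwoWalkParabolic : {n : ℕ} → Graph n → ℕ → ℕ → Set
TwoWalkParabolic G a b =
  ParabolicPair G a b × (∀ a' b' → ParabolicPair G a' b' → a' ≡ a × b' ≡ b)

-- G₀ = G minus all pendant vertices. Its vertices are the non-pendant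
-- vertices of G, and the degree of such a vertex v in G₀ is the number
-- of non-pendant neighbours of v in G.
degG₀ : {n : ℕ} → Graph n → Fin n → ℕ
degG₀ G v = Σv (λ u → if adj G v u ∧ not (does (deg G u ≟ 1)) then 1 else 0)

MinDegG₀≥ : {n : ℕ} → Graph n → ℕ → Set
MinDegG₀≥ {n} G k = ∀ (v : Fin n) → deg G v ≢ 1 → k ≤ degG₀ G v

{-# OPTIONS --safe #-}
-- Write s(v) = d(v) + e(v), where the excess e(v) sums d(u) - 1 over the neighbours u of v.
-- At a pendant vertex the parabola gives a = c + 1 + b with c the degree of its neighbour, so
-- every support vertex has degree c and the parabola reads e(v) + d(v)² + b = (c + b) d(v).
-- A connected unicyclic graph has no edge uw all of whose other neighbours are pendant: such a
-- "double star" is a tree. Hence every vertex has a non-pendant neighbour. If a non-pendant v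
-- had only one, w, then v is a support vertex, e(v) = d(w) - 1 gives d(w) - 1 + b = bc, and
-- the double-star obstruction at w forces e(w) ≥ d(w), which the parabola at w forbids.
-- For (ii), a support vertex has degree c ≥ 3, and b = 0 would force its excess to vanish,
-- contradicting its non-pendant neighbour.
module Submission where

open import Defs renaming (sym to adj-sym; irrefl to adj-irrefl)
open import Data.Nat
open import Data.Nat.Properties
open import Data.Nat.ListAction using () renaming (sum to listSum)
open import Data.Nat.Tactic.RingSolver using (solve-∀)
open import Data.Bool using (Bool; true; false; if_then_else_; _∧_; not; T)
open import Data.Unit using (tt)
open import Data.Fin using (Fin; zero; suc; toℕ; punchIn; punchOut) renaming (_≟_ to _≟ᶠ_)
open import Data.Fin.Properties using (toℕ-injective; punchInᵢ≢i; punchIn-injective; punchIn-punchOut)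
open import Data.Vec.Functional using (removeAt)
open import Data.Vec.Functional.Properties using (removeAt-punchOut)
open import Data.List using (tabulate)
open import Data.List.Properties using (map-tabulate)
open import Data.Product using (_×_; _,_; proj₁; proj₂; ∃-syntax; map₂)
open import Function using (_∘_; id)
open import Relation.Binary.PropositionalEquality
open import Relation.Nullary using (¬_; Dec; yes; no; does; contradiction)
open import Relation.Nullary.Decidable using (dec-true; dec-false)
open import Algebra.Properties.CommutativeMonoid.Sum +-0-commutativeMonoid
  using (sum; sum-cong-≗; ∑-distrib-+; ∑-comm; sum-remove; sum-replicate-zero)

-- Finite sums

listSum-tabulate : ∀ {n} (f : Fin n → ℕ) → listSum (tabulate f) ≡ sum f
listSum-tabulate {zero}  f = refl
listSum-tabulate {suc n} f = cong (f zero +_) (listSum-tabulate (f ∘ suc))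

Σv≡sum : ∀ {n} (f : Fin n → ℕ) → Σv f ≡ sum f
Σv≡sum f = trans (cong listSum (map-tabulate id f)) (listSum-tabulate f)

sum-ones : ∀ n → sum {n} (λ _ → 1) ≡ n
sum-ones zero    = refl
sum-ones (suc n) = cong suc (sum-ones n)

sum-mono-≤ : ∀ {n} {f g : Fin n → ℕ} → (∀ i → f i ≤ g i) → sum f ≤ sum g
sum-mono-≤ {zero}  f≤g = z≤n
sum-mono-≤ {suc n} f≤g = +-mono-≤ (f≤g zero) (sum-mono-≤ (f≤g ∘ suc))

term≤sum : ∀ {n} (f : Fin n → ℕ) i → f i ≤ sum f
term≤sum {suc _} f i = subst (f i ≤_) (sym (sum-remove {i = i} f)) (m≤m+n (f i) _)

two-terms≤sum : ∀ {n} (f : Fin n → ℕ) {i j} → i ≢ j → f i + f j ≤ sum f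
two-terms≤sum {suc _} f {i} {j} i≢j = begin
  f i + f j                          ≡⟨ cong (f i +_) (removeAt-punchOut f i≢j) ⟨
  f i + removeAt f i (punchOut i≢j)  ≤⟨ +-monoʳ-≤ (f i) (term≤sum (removeAt f i) _) ⟩
  f i + sum (removeAt f i)           ≡⟨ sum-remove f ⟨
  sum f                              ∎
  where open ≤-Reasoning

sum-pos⇒term-pos : ∀ {n} (f : Fin n → ℕ) → 0 < sum f → ∃[ i ] 0 < f i
sum-pos⇒term-pos {suc _} f pos with f zero in f₀
... | suc _ = zero , subst (0 <_) (sym f₀) z<s
... | zero with sum-pos⇒term-pos (f ∘ suc) pos
...   | i , pos-i = suc i , pos-i

sum-concentrated : ∀ {n} (f : Fin n → ℕ) i → (∀ j → j ≢ i → f j ≡ 0) → sum f ≡ f i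
sum-concentrated {suc n} f i vanish = begin
  sum f                     ≡⟨ sum-remove f ⟩
  f i + sum (removeAt f i)  ≡⟨ cong (f i +_) (sum-cong-≗ (λ k → vanish _ (punchInᵢ≢i i k))) ⟩
  f i + sum {n} (λ _ → 0)   ≡⟨ cong (f i +_) (sum-replicate-zero n) ⟩
  f i + 0                   ≡⟨ +-identityʳ (f i) ⟩
  f i                       ∎
  where open ≡-Reasoning

sum-concentrated₂ : ∀ {n} (f : Fin n → ℕ) {i j} → i ≢ j →
                    (∀ k → k ≢ i → k ≢ j → f k ≡ 0) → sum f ≡ f i + f j
sum-concentrated₂ {suc _} f {i} {j} i≢j vanish = begin
  sum f                              ≡⟨ sum-remove f ⟩
  f i + sum (removeAt f i)           ≡⟨ cong (f i +_) (sum-concentrated (removeAt f i) (punchOut i≢j) vanish′) ⟩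
  f i + removeAt f i (punchOut i≢j)  ≡⟨ cong (f i +_) (removeAt-punchOut f i≢j) ⟩
  f i + f j                          ∎
  where
  open ≡-Reasoning
  vanish′ : ∀ k → k ≢ punchOut i≢j → f (punchIn i k) ≡ 0
  vanish′ k k≢ = vanish _ (punchInᵢ≢i i k)
    (λ eq → k≢ (punchIn-injective i k _ (trans eq (sym (punchIn-punchOut i≢j)))))

-- Counting

indicator : Bool → ℕ
indicator b = if b then 1 else 0

count : ∀ {n} → (Fin n → Bool) → ℕ
count p = sum (indicator ∘ p)

indicator-pos⇒true : ∀ {b} → 0 < indicator b → b ≡ true
indicator-pos⇒true {true} _ = refl

count-witness : ∀ {n} (p : Fin n → Bool) → 1 ≤ count p → ∃[ i ] p i ≡ true
count-witness p pos = map₂ indicator-pos⇒true (sum-pos⇒term-pos (indicator ∘ p) pos)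

count-pos : ∀ {n} (p : Fin n → Bool) {i} → p i ≡ true → 1 ≤ count p
count-pos p {i} pi = subst (_≤ count p) (cong indicator pi) (term≤sum (indicator ∘ p) i)

count≤1⇒unique : ∀ {n} (p : Fin n → Bool) → count p ≤ 1 →
                 ∀ {i j} → p i ≡ true → p j ≡ true → i ≡ j
count≤1⇒unique p ≤1 {i} {j} pi pj with i ≟ᶠ j
... | yes i≡j = i≡j
... | no i≢j  = contradiction (≤-trans two≤ ≤1) 1+n≰n
  where
  two≤ : 2 ≤ count p
  two≤ = subst (_≤ count p) (cong₂ _+_ (cong indicator pi) (cong indicator pj))
               (two-terms≤sum (indicator ∘ p) i≢j)

count-split : ∀ {n} (p q : Fin n → Bool) →
              count p ≡ count (λ i → p i ∧ not (q i)) + count (λ i → p i ∧ q i)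
count-split p q = trans (sum-cong-≗ split)
  (∑-distrib-+ (λ i → indicator (p i ∧ not (q i))) (λ i → indicator (p i ∧ q i)))
  where
  split : ∀ i → indicator (p i) ≡ indicator (p i ∧ not (q i)) + indicator (p i ∧ q i)
  split i with p i | q i
  ... | false | _     = refl
  ... | true  | false = refl
  ... | true  | true  = refl

∧-true : ∀ {x y} → (x ∧ y) ≡ true → x ≡ true × y ≡ true
∧-true {true} {true} _ = refl , refl

does-true : ∀ {P : Set} (P? : Dec P) → does P? ≡ true → P
does-true (yes p) _ = p

does-false : ∀ {P : Set} (P? : Dec P) → not (does P?) ≡ true → ¬ P
does-false (no ¬p) _ = ¬p

-- Degrees, excess and double-star edges

module _ {n : ℕ} (G : Graph n) where

  adjacent-sym : ∀ {u v} → adj G u v ≡ true → adj G v u ≡ true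
  adjacent-sym {u} {v} uv = trans (adj-sym G v u) uv

  adjacent⇒≢ : ∀ {u v} → adj G u v ≡ true → u ≢ v
  adjacent⇒≢ {u} uv refl with trans (sym uv) (adj-irrefl G u)
  ... | ()

  deg≡count : ∀ v → deg G v ≡ count (adj G v)
  deg≡count v = Σv≡sum (indicator ∘ adj G v)

  deg-pos⇒neighbour : ∀ {v} → 1 ≤ deg G v → ∃[ u ] adj G v u ≡ true
  deg-pos⇒neighbour {v} pos = count-witness (adj G v) (subst (1 ≤_) (deg≡count v) pos)

  neighbour⇒deg-pos : ∀ {u v} → adj G u v ≡ true → 1 ≤ deg G v
  neighbour⇒deg-pos {v = v} uv =
    subst (1 ≤_) (sym (deg≡count v)) (count-pos (adj G v) (adjacent-sym uv))

  pendant-neighbour-unique : ∀ {x y z} → Pendant G x →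
                             adj G x y ≡ true → adj G x z ≡ true → y ≡ z
  pendant-neighbour-unique {x} px =
    count≤1⇒unique (adj G x) (subst (_≤ 1) (deg≡count x) (≤-reflexive px))

  OnlyPendantsBesides : Fin n → Fin n → Set
  OnlyPendantsBesides v w = ∀ x → adj G v x ≡ true → x ≢ w → Pendant G x

  pendant⇒onlyPendantsBesides : ∀ {x y} → Pendant G x → adj G x y ≡ true →
                                 OnlyPendantsBesides x y
  pendant⇒onlyPendantsBesides px xy z xz z≢y =
    contradiction (pendant-neighbour-unique px xz xy) z≢y

  ascending : Fin n → Fin n → ℕ
  ascending u v = indicator ((toℕ u <ᵇ toℕ v) ∧ adj G u v)

  adjacency-split : ∀ v u → indicator (adj G v u) ≡
    indicator ((toℕ v <ᵇ toℕ u) ∧ adj G v u) + indicator ((toℕ u <ᵇ toℕ v) ∧ adj G u v)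
  adjacency-split v u with toℕ v <ᵇ toℕ u in v<u | toℕ u <ᵇ toℕ v in u<v
  ... | true  | true  = contradiction (<ᵇ-true {toℕ v} v<u) (<-asym (<ᵇ-true {toℕ u} u<v))
    where
    <ᵇ-true : ∀ {m k} → (m <ᵇ k) ≡ true → m < k
    <ᵇ-true {m} {k} eq = <ᵇ⇒< m k (subst T (sym eq) tt)
  ... | true  | false = sym (+-identityʳ _)
  ... | false | true  = cong indicator (adj-sym G v u)
  ... | false | false = cong indicator (trans (cong (adj G v) (sym v≡u)) (adj-irrefl G v))
    where
    <ᵇ-false : ∀ {m k} → (m <ᵇ k) ≡ false → ¬ m < k
    <ᵇ-false eq lt = subst T eq (<⇒<ᵇ lt)
    v≡u : v ≡ u
    v≡u = toℕ-injective (≤-antisym (≮⇒≥ (<ᵇ-false u<v)) (≮⇒≥ (<ᵇ-false v<u)))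

  handshake : sum (deg G) ≡ edgeCount G + edgeCount G
  handshake = begin
    sum (deg G)                                              ≡⟨ sum-cong-≗ (λ v → trans (deg≡count v) (sum-cong-≗ (adjacency-split v))) ⟩
    sum (λ v → sum (λ u → ascending v u + ascending u v))    ≡⟨ sum-cong-≗ (λ v → ∑-distrib-+ (ascending v) (λ u → ascending u v)) ⟩
    sum (λ v → sum (ascending v) + sum (λ u → ascending u v)) ≡⟨ ∑-distrib-+ (λ v → sum (ascending v)) (λ v → sum (λ u → ascending u v)) ⟩
    E + sum (λ v → sum (λ u → ascending u v))                ≡⟨ cong (E +_) (∑-comm ascending) ⟨
    E + E                                                    ≡⟨ cong₂ _+_ edgeCount≡E edgeCount≡E ⟨
    edgeCount G + edgeCount G                                ∎
    where
    open ≡-Reasoning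
    E : ℕ
    E = sum (λ u → sum (ascending u))
    edgeCount≡E : edgeCount G ≡ E
    edgeCount≡E = trans (Σv≡sum (λ u → Σv (ascending u))) (sum-cong-≗ (λ u → Σv≡sum (ascending u)))

  excessTerm : Fin n → Fin n → ℕ
  excessTerm v u = if adj G v u then deg G u ∸ 1 else 0

  excess : Fin n → ℕ
  excess v = sum (excessTerm v)

  excessTerm-adjacent : ∀ {v u} → adj G v u ≡ true → excessTerm v u ≡ deg G u ∸ 1
  excessTerm-adjacent {u = u} vu = cong (λ b → if b then deg G u ∸ 1 else 0) vu

  s≡deg+excess : ∀ v → s G v ≡ deg G v + excess v
  s≡deg+excess v = begin
    s G v                                                  ≡⟨ Σv≡sum (λ u → if adj G v u then deg G u else 0) ⟩
    sum (λ u → if adj G v u then deg G u else 0)           ≡⟨ sum-cong-≗ split ⟩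
    sum (λ u → indicator (adj G v u) + excessTerm v u)     ≡⟨ ∑-distrib-+ (indicator ∘ adj G v) (excessTerm v) ⟩
    count (adj G v) + excess v                             ≡⟨ cong (_+ excess v) (deg≡count v) ⟨
    deg G v + excess v                                     ∎
    where
    open ≡-Reasoning
    split : ∀ u → (if adj G v u then deg G u else 0) ≡ indicator (adj G v u) + excessTerm v u
    split u with adj G v u in vu
    ... | false = refl
    ... | true  = sym (m+[n∸m]≡n (neighbour⇒deg-pos vu))

  neighbour-excess≤excess : ∀ {v u} → adj G v u ≡ true → deg G u ∸ 1 ≤ excess v
  neighbour-excess≤excess {v} {u} vu =
    subst (_≤ excess v) (excessTerm-adjacent vu) (term≤sum (excessTerm v) u)

  two-neighbour-excesses≤excess : ∀ {v x y} → adj G v x ≡ true → adj G v y ≡ true → x ≢ y →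
                                  (deg G x ∸ 1) + (deg G y ∸ 1) ≤ excess v
  two-neighbour-excesses≤excess {v} vx vy x≢y =
    subst (_≤ excess v) (cong₂ _+_ (excessTerm-adjacent vx) (excessTerm-adjacent vy))
          (two-terms≤sum (excessTerm v) x≢y)

  deg≤excess : ∀ {v} → (∀ u → adj G v u ≡ true → 2 ≤ deg G u) → deg G v ≤ excess v
  deg≤excess {v} neighbours≥2 = subst (_≤ excess v) (sym (deg≡count v)) (sum-mono-≤ pointwise)
    where
    pointwise : ∀ u → indicator (adj G v u) ≤ excessTerm v u
    pointwise u with adj G v u in vu
    ... | false = z≤n
    ... | true  = m<n⇒0<n∸m (neighbours≥2 u vu)

  excess-concentrated : ∀ {v w} → adj G v w ≡ true → OnlyPendantsBesides v w →
                        excess v ≡ deg G w ∸ 1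
  excess-concentrated {v} {w} vw others =
    trans (sum-concentrated (excessTerm v) w vanish) (excessTerm-adjacent vw)
    where
    vanish : ∀ x → x ≢ w → excessTerm v x ≡ 0
    vanish x x≢w with adj G v x in vx
    ... | false = refl
    ... | true  = cong (_∸ 1) (others x vx x≢w)

  s-pendant : ∀ {x y} → Pendant G x → adj G x y ≡ true → s G x ≡ deg G y
  s-pendant {x} {y} px xy = begin
    s G x               ≡⟨ s≡deg+excess x ⟩
    deg G x + excess x  ≡⟨ cong₂ _+_ px (excess-concentrated xy (pendant⇒onlyPendantsBesides px xy)) ⟩
    1 + (deg G y ∸ 1)   ≡⟨ m+[n∸m]≡n (neighbour⇒deg-pos xy) ⟩
    deg G y             ∎
    where open ≡-Reasoning

  nonPendantNeighbour pendantNeighbour : Fin n → Fin n → Bool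
  nonPendantNeighbour v u = adj G v u ∧ not (does (deg G u ≟ 1))
  pendantNeighbour    v u = adj G v u ∧ does (deg G u ≟ 1)

  degG₀≡count : ∀ v → degG₀ G v ≡ count (nonPendantNeighbour v)
  degG₀≡count v = Σv≡sum (indicator ∘ nonPendantNeighbour v)

  deg-split : ∀ v → deg G v ≡ degG₀ G v + count (pendantNeighbour v)
  deg-split v = trans (deg≡count v) (trans (count-split (adj G v) (λ u → does (deg G u ≟ 1)))
                                           (cong (_+ count (pendantNeighbour v)) (sym (degG₀≡count v))))

  degG₀-witness : ∀ {v} → 1 ≤ degG₀ G v → ∃[ w ] adj G v w ≡ true × ¬ Pendant G w
  degG₀-witness {v} pos with count-witness (nonPendantNeighbour v) (subst (1 ≤_) (degG₀≡count v) pos)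
  ... | w , vw with ∧-true vw
  ...   | vw′ , ¬pw = w , vw′ , does-false (deg G w ≟ 1) ¬pw

  nonPendantNeighbour-marks : ∀ {v u} → adj G v u ≡ true → ¬ Pendant G u → nonPendantNeighbour v u ≡ true
  nonPendantNeighbour-marks {u = u} vu ¬pu rewrite vu | dec-false (deg G u ≟ 1) ¬pu = refl

  pendantNeighbour-marks : ∀ {v u} → adj G v u ≡ true → Pendant G u → pendantNeighbour v u ≡ true
  pendantNeighbour-marks {u = u} vu pu rewrite vu | dec-true (deg G u ≟ 1) pu = refl

  degG₀-pos : ∀ {v w} → adj G v w ≡ true → ¬ Pendant G w → 1 ≤ degG₀ G v
  degG₀-pos {v} vw ¬pw =
    subst (1 ≤_) (sym (degG₀≡count v)) (count-pos (nonPendantNeighbour v) (nonPendantNeighbour-marks vw ¬pw))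

  degG₀≤1-unique : ∀ {v x y} → degG₀ G v ≤ 1 → adj G v x ≡ true → ¬ Pendant G x →
                   adj G v y ≡ true → ¬ Pendant G y → x ≡ y
  degG₀≤1-unique {v} ≤1 vx ¬px vy ¬py =
    count≤1⇒unique (nonPendantNeighbour v) (subst (_≤ 1) (degG₀≡count v) ≤1)
                   (nonPendantNeighbour-marks vx ¬px) (nonPendantNeighbour-marks vy ¬py)

  pendantNeighbour-witness : ∀ {v} → 1 ≤ count (pendantNeighbour v) → ∃[ x ] adj G v x ≡ true × Pendant G x
  pendantNeighbour-witness {v} pos with count-witness (pendantNeighbour v) pos
  ... | x , vx with ∧-true vx
  ...   | vx′ , px = x , vx′ , does-true (deg G x ≟ 1) px

  pendantNeighbour-pos : ∀ {v x} → adj G v x ≡ true → Pendant G x → 1 ≤ count (pendantNeighbour v)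
  pendantNeighbour-pos {v} vx px = count-pos (pendantNeighbour v) (pendantNeighbour-marks vx px)

  reachable-closed : (P : Fin n → Set) → (∀ {x y} → P x → adj G x y ≡ true → P y) →
                     ∀ {u v} → Reachable G u v → P u → P v
  reachable-closed P closed here         pu = pu
  reachable-closed P closed (step uw wv) pu = reachable-closed P closed wv (closed pu uw)

  DoubleStarEdge : Fin n → Fin n → Set
  DoubleStarEdge u w = adj G u w ≡ true × OnlyPendantsBesides u w × OnlyPendantsBesides w u

  leaf-of-star : ∀ {p q v} → adj G p q ≡ true → OnlyPendantsBesides p q →
                 adj G p v ≡ true → v ≢ q → Pendant G v × adj G q v ≡ false
  leaf-of-star {p} {q} {v} pq others pv v≢q = pendant-v , not-adjacent
    where
    pendant-v : Pendant G v
    pendant-v = others v pv v≢q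
    not-adjacent : adj G q v ≡ false
    not-adjacent with adj G q v in qv
    ... | false = refl
    ... | true  = contradiction (pendant-neighbour-unique pendant-v (adjacent-sym pv) (adjacent-sym qv))
                                (adjacent⇒≢ pq)

  data NearEdge (u w : Fin n) : Fin n → Set where
    endpoint₁ : NearEdge u w u
    endpoint₂ : NearEdge u w w
    beside₁   : ∀ {v} → adj G u v ≡ true → NearEdge u w v
    beside₂   : ∀ {v} → adj G w v ≡ true → NearEdge u w v

  module DoubleStar (connected : Connected G) {u w : Fin n} (uw : adj G u w ≡ true)
                    (others-u : OnlyPendantsBesides u w) (others-w : OnlyPendantsBesides w u) where

    near : ∀ v → NearEdge u w v
    near v = reachable-closed (NearEdge u w) closed (connected u v) endpoint₁
      where
      closed : ∀ {x y} → NearEdge u w x → adj G x y ≡ true → NearEdge u w y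
      closed endpoint₁ uy = beside₁ uy
      closed endpoint₂ wy = beside₂ wy
      closed {x} (beside₁ ux) xy with x ≟ᶠ w
      ... | yes refl = beside₂ xy
      ... | no x≢w   = subst (NearEdge u w)
                             (pendant-neighbour-unique (others-u x ux x≢w) (adjacent-sym ux) xy) endpoint₁
      closed {x} (beside₂ wx) xy with x ≟ᶠ u
      ... | yes refl = beside₁ xy
      ... | no x≢u   = subst (NearEdge u w)
                             (pendant-neighbour-unique (others-w x wx x≢u) (adjacent-sym wx) xy) endpoint₂

    off-centre : ∀ v → v ≢ u → v ≢ w →
                 Pendant G v × indicator (adj G u v) + indicator (adj G w v) ≡ 1
    off-centre v v≢u v≢w with near v
    ... | endpoint₁ = contradiction refl v≢u
    ... | endpoint₂ = contradiction refl v≢w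
    ... | beside₁ uv with leaf-of-star uw others-u uv v≢w
    ...   | pv , wv = pv , cong₂ _+_ (cong indicator uv) (cong indicator wv)
    off-centre v v≢u v≢w | beside₂ wv with leaf-of-star (adjacent-sym uw) others-w wv v≢u
    ...   | pv , uv = pv , cong₂ _+_ (cong indicator uv) (cong indicator wv)

    covered-once : ∀ v → indicator (adj G u v) + indicator (adj G w v) ≡ 1
    covered-once v with v ≟ᶠ u | v ≟ᶠ w
    ... | yes refl | _        = cong₂ _+_ (cong indicator (adj-irrefl G u)) (cong indicator (adjacent-sym uw))
    ... | no _     | yes refl = cong₂ _+_ (cong indicator uw) (cong indicator (adj-irrefl G w))
    ... | no v≢u   | no v≢w   = proj₂ (off-centre v v≢u v≢w)

    all-deg-pos : ∀ v → 1 ≤ deg G v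
    all-deg-pos v with near v
    ... | endpoint₁  = neighbour⇒deg-pos (adjacent-sym uw)
    ... | endpoint₂  = neighbour⇒deg-pos uw
    ... | beside₁ uv = neighbour⇒deg-pos uv
    ... | beside₂ wv = neighbour⇒deg-pos wv

    order : n ≡ deg G u + deg G w
    order = begin
      n                                                          ≡⟨ sum-ones n ⟨
      sum {n} (λ _ → 1)                                          ≡⟨ sum-cong-≗ covered-once ⟨
      sum (λ v → indicator (adj G u v) + indicator (adj G w v))  ≡⟨ ∑-distrib-+ (indicator ∘ adj G u) (indicator ∘ adj G w) ⟩
      count (adj G u) + count (adj G w)                          ≡⟨ cong₂ _+_ (deg≡count u) (deg≡count w) ⟨
      deg G u + deg G w                                          ∎
      where open ≡-Reasoning

    degree-sum : sum (deg G) ≡ n + ((deg G u ∸ 1) + (deg G w ∸ 1))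
    degree-sum = begin
      sum (deg G)                                 ≡⟨ sum-cong-≗ (λ v → m+[n∸m]≡n (all-deg-pos v)) ⟨
      sum (λ v → 1 + (deg G v ∸ 1))               ≡⟨ ∑-distrib-+ (λ _ → 1) (λ v → deg G v ∸ 1) ⟩
      sum {n} (λ _ → 1) + sum (λ v → deg G v ∸ 1) ≡⟨ cong₂ _+_ (sum-ones n) (sum-concentrated₂ (λ v → deg G v ∸ 1) (adjacent⇒≢ uw) vanish) ⟩
      n + ((deg G u ∸ 1) + (deg G w ∸ 1))         ∎
      where
      open ≡-Reasoning
      vanish : ∀ v → v ≢ u → v ≢ w → deg G v ∸ 1 ≡ 0
      vanish v v≢u v≢w = cong (_∸ 1) (proj₁ (off-centre v v≢u v≢w))

  -- A double-star edge uw makes G a tree: it has d(u) + d(w) = n vertices, but degree sum 2n - 2.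
  unicyclic⇒no-doubleStar : ConnectedUnicyclic G → ∀ u w → ¬ DoubleStarEdge u w
  unicyclic⇒no-doubleStar (connected , edges≡n) u w (uw , others-u , others-w) = m≢1+n+m extra {1} (begin
    extra                              ≡⟨ +-cancelˡ-≡ n _ _ (trans (sym degree-sum) (trans handshake (cong₂ _+_ edges≡n edges≡n))) ⟩
    n                                     ≡⟨ order ⟩
    deg G u + deg G w                     ≡⟨ cong₂ _+_ (m+[n∸m]≡n (all-deg-pos u)) (m+[n∸m]≡n (all-deg-pos w)) ⟨
    suc (deg G u ∸ 1) + suc (deg G w ∸ 1) ≡⟨ cong suc (+-suc (deg G u ∸ 1) (deg G w ∸ 1)) ⟩
    suc (1 + extra)                    ∎)
    where
    open DoubleStar connected uw others-u others-w
    open ≡-Reasoning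
    extra : ℕ
    extra = (deg G u ∸ 1) + (deg G w ∸ 1)

-- Parabolic graphs

cancel-degree-term : ∀ d e b c → d + e + d * d + b ≡ (c + 1 + b) * d → e + d * d + b ≡ (c + b) * d
cancel-degree-term d e b c eq = +-cancelˡ-≡ d _ _ (trans (regroup d e b) (trans eq (expand d b c)))
  where
  regroup : ∀ d e b → d + (e + d * d + b) ≡ d + e + d * d + b
  regroup = solve-∀
  expand : ∀ d b c → (c + 1 + b) * d ≡ d + (c + b) * d
  expand = solve-∀

support-excess-arith : ∀ e b c → e + c * c + b ≡ (c + b) * c → e + b ≡ b * c
support-excess-arith e b c eq = +-cancelˡ-≡ (c * c) _ _ (trans (regroup e b c) (trans eq (*-distribʳ-+ c c b)))
  where
  regroup : ∀ e b c → c * c + (e + b) ≡ e + c * c + b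
  regroup = solve-∀

-- w + 1 - (c + b) = (b - 1)(c - 2) ≥ 0.
link-bound : ∀ {b c w} → 1 ≤ b → 2 ≤ c → 1 ≤ w → w ∸ 1 + b ≡ b * c → c + b ≤ w + 1
link-bound {suc b} {suc zero} _ (s≤s ()) _ _
link-bound {suc b} {suc (suc c)} {w} _ _ w≥1 link = begin
  suc (suc c) + suc b          ≤⟨ m≤m+n _ (b * c) ⟩
  suc (suc c) + suc b + b * c  ≡⟨ +-cancelʳ-≡ (suc b) _ _ shifted ⟩
  w ∸ 1 + 2                    ≡⟨ +-assoc (w ∸ 1) 1 1 ⟨
  w ∸ 1 + 1 + 1                ≡⟨ cong (_+ 1) (m∸n+n≡m w≥1) ⟩
  w + 1                        ∎
  where
  open ≤-Reasoning
  lhs : ∀ b c → suc (suc c) + suc b + b * c + suc b ≡ suc b * suc (suc c) + 2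
  lhs = solve-∀
  rhs : ∀ m b → m + suc b + 2 ≡ m + 2 + suc b
  rhs = solve-∀
  shifted : suc (suc c) + suc b + b * c + suc b ≡ w ∸ 1 + 2 + suc b
  shifted = trans (lhs b c) (trans (cong (_+ 2) (sym link)) (rhs (w ∸ 1) b))

partner-excess<deg : ∀ {b c w e} → 2 ≤ c → 2 ≤ w → w ∸ 1 + b ≡ b * c →
                     e + w * w + b ≡ (c + b) * w → e < w
partner-excess<deg {zero} {w = w} _ w≥2 link _ =
  contradiction (trans (sym (+-identityʳ (w ∸ 1))) link) (n>0⇒n≢0 (m<n⇒0<n∸m w≥2))
partner-excess<deg {suc b} {c} {w} {e} c≥2 w≥2 link eq = +-cancelʳ-≤ (w * w) (suc e) w (begin
  suc e + w * w      ≤⟨ m≤m+n (suc e + w * w) b ⟩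
  suc e + w * w + b  ≡⟨ shuffle e w b ⟩
  e + w * w + suc b  ≡⟨ eq ⟩
  (c + suc b) * w    ≤⟨ *-monoˡ-≤ w (link-bound (s≤s z≤n) c≥2 (≤-trans (s≤s z≤n) w≥2) link) ⟩
  (w + 1) * w        ≡⟨ expand w ⟩
  w + w * w          ∎)
  where
  open ≤-Reasoning
  shuffle : ∀ e w b → suc e + w * w + b ≡ e + w * w + suc b
  shuffle = solve-∀
  expand : ∀ w → (w + 1) * w ≡ w + w * w
  expand = solve-∀

module _ {n : ℕ} (G : Graph n) {a b : ℕ}
         (parabolic : ∀ v → s G v + deg G v * deg G v + b ≡ a * deg G v) where

  parabola-at-pendant : ∀ {x y} → Pendant G x → adj G x y ≡ true → a ≡ deg G y + 1 + b
  parabola-at-pendant {x} {y} px xy = sym (begin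
    deg G y + 1 + b                ≡⟨ cong (λ t → t + 1 + b) (s-pendant G px xy) ⟨
    s G x + 1 + b                  ≡⟨ cong (λ d → s G x + d * d + b) px ⟨
    s G x + deg G x * deg G x + b  ≡⟨ parabolic x ⟩
    a * deg G x                    ≡⟨ cong (a *_) px ⟩
    a * 1                          ≡⟨ *-identityʳ a ⟩
    a                              ∎)
    where open ≡-Reasoning

  parabola-in-excess-form : ∀ {c} → a ≡ c + 1 + b →
    ∀ v → excess G v + deg G v * deg G v + b ≡ (c + b) * deg G v
  parabola-in-excess-form {c} refl v = cancel-degree-term (deg G v) (excess G v) b c
    (trans (cong (λ t → t + deg G v * deg G v + b) (sym (s≡deg+excess G v))) (parabolic v))

module Parabolic {n : ℕ} {G : Graph n} {b c : ℕ}
  (no-doubleStar : ∀ u w → ¬ DoubleStarEdge G u w)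
  (deg-pos : ∀ v → 1 ≤ deg G v)
  (parabolic : ∀ v → excess G v + deg G v * deg G v + b ≡ (c + b) * deg G v)
  where

  nonPendant⇒deg≥2 : ∀ {v} → ¬ Pendant G v → 2 ≤ deg G v
  nonPendant⇒deg≥2 {v} ¬pv = ≤∧≢⇒< (deg-pos v) (¬pv ∘ sym)

  support-deg : ∀ {x y} → Pendant G x → adj G x y ≡ true → deg G y ≡ c
  support-deg {x} {y} px xy = begin
    deg G y          ≡⟨ m∸n+n≡m (neighbour⇒deg-pos G xy) ⟨
    deg G y ∸ 1 + 1  ≡⟨ cong (_+ 1) (excess-concentrated G xy (pendant⇒onlyPendantsBesides G px xy)) ⟨
    excess G x + 1   ≡⟨ +-cancelʳ-≡ b _ _ at-x ⟩
    c                ∎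
    where
    open ≡-Reasoning
    at-x : excess G x + 1 + b ≡ c + b
    at-x = trans (subst (λ d → excess G x + d * d + b ≡ (c + b) * d) px (parabolic x)) (*-identityʳ (c + b))

  support-excess : ∀ {v} → deg G v ≡ c → excess G v + b ≡ b * c
  support-excess {v} dv = support-excess-arith (excess G v) b c
    (subst (λ d → excess G v + d * d + b ≡ (c + b) * d) dv (parabolic v))

  degG₀≢0 : ∀ v → degG₀ G v ≢ 0
  degG₀≢0 v d₀≡0 with deg-pos⇒neighbour G (deg-pos v)
  ... | w , vw = no-doubleStar v w
        (vw , (λ x vx _ → all-pendant x vx) , pendant⇒onlyPendantsBesides G (all-pendant w vw) (adjacent-sym G vw))
    where
    all-pendant : ∀ x → adj G v x ≡ true → Pendant G x
    all-pendant x vx with deg G x ≟ 1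
    ... | yes px = px
    ... | no ¬px = contradiction (subst (1 ≤_) d₀≡0 (degG₀-pos G vx ¬px)) λ ()

  nonPendant-neighbour : ∀ v → ∃[ w ] adj G v w ≡ true × ¬ Pendant G w
  nonPendant-neighbour v = degG₀-witness G (n≢0⇒n>0 (degG₀≢0 v))

  support-nonPendant : ∀ {x y} → Pendant G x → adj G x y ≡ true → ¬ Pendant G y
  support-nonPendant px xy with nonPendant-neighbour _
  ... | w , xw , ¬pw = subst (¬_ ∘ Pendant G) (pendant-neighbour-unique G px xw xy) ¬pw

  -- w cannot be a support vertex: then d(w) = c = d(v), and a second non-pendant
  -- neighbour of w, which the double-star obstruction provides, would give e(w) ≥ d(w).
  lone-partner-impossible : ∀ {x v w} → Pendant G x → adj G x v ≡ true →
    adj G v w ≡ true → ¬ Pendant G w → ¬ OnlyPendantsBesides G v w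
  lone-partner-impossible {v = v} {w} px xv vw ¬pw others =
    <⇒≱ excess<deg (deg≤excess G (λ u wu → nonPendant⇒deg≥2 (no-pendant-neighbour u wu)))
    where
    dv≡c : deg G v ≡ c
    dv≡c = support-deg px xv
    excess<deg : excess G w < deg G w
    excess<deg = partner-excess<deg (subst (2 ≤_) dv≡c (nonPendant⇒deg≥2 (support-nonPendant px xv)))
      (nonPendant⇒deg≥2 ¬pw)
      (trans (cong (_+ b) (sym (excess-concentrated G vw others))) (support-excess dv≡c))
      (parabolic w)
    no-pendant-neighbour : ∀ z → adj G w z ≡ true → ¬ Pendant G z
    no-pendant-neighbour z wz pz = no-doubleStar v w (vw , others , others-w)
      where
      others-w : OnlyPendantsBesides G w v
      others-w y wy y≢v with deg G y ≟ 1
      ... | yes py = py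
      ... | no ¬py = contradiction excess<deg (≤⇒≯ (begin
        deg G w                        ≡⟨ trans (support-deg pz (adjacent-sym G wz)) (sym dv≡c) ⟩
        deg G v                        ≡⟨ m∸n+n≡m (deg-pos v) ⟨
        deg G v ∸ 1 + 1                ≤⟨ +-monoʳ-≤ (deg G v ∸ 1) (m<n⇒0<n∸m (nonPendant⇒deg≥2 ¬py)) ⟩
        (deg G v ∸ 1) + (deg G y ∸ 1)  ≤⟨ two-neighbour-excesses≤excess G (adjacent-sym G vw) wy (y≢v ∘ sym) ⟩
        excess G w                     ∎))
        where open ≤-Reasoning

  few-nonPendant⇒pendant-neighbour : ∀ {v} → ¬ Pendant G v → degG₀ G v ≤ 1 →
                                     ∃[ x ] adj G v x ≡ true × Pendant G x
  few-nonPendant⇒pendant-neighbour {v} ¬pv d₀≤1 = pendantNeighbour-witness G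
    (+-cancelˡ-≤ 1 1 _ (≤-trans (nonPendant⇒deg≥2 ¬pv)
                       (≤-trans (≤-reflexive (deg-split G v)) (+-monoˡ-≤ _ d₀≤1))))

  degG₀≢1 : ∀ {v} → ¬ Pendant G v → degG₀ G v ≢ 1
  degG₀≢1 {v} ¬pv d₀≡1
    with degG₀-witness G (≤-reflexive (sym d₀≡1)) | few-nonPendant⇒pendant-neighbour ¬pv (≤-reflexive d₀≡1)
  ... | w , vw , ¬pw | x , vx , px = lone-partner-impossible px (adjacent-sym G vx) vw ¬pw others
    where
    others : OnlyPendantsBesides G v w
    others y vy y≢w with deg G y ≟ 1
    ... | yes py = py
    ... | no ¬py = contradiction (degG₀≤1-unique G (≤-reflexive d₀≡1) vy ¬py vw ¬pw) y≢w

  degG₀≥2 : MinDegG₀≥ G 2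
  degG₀≥2 v ¬pv with degG₀ G v in d₀
  ... | zero        = contradiction d₀ (degG₀≢0 v)
  ... | suc zero    = contradiction d₀ (degG₀≢1 ¬pv)
  ... | suc (suc _) = s≤s (s≤s z≤n)

  support-deg≥3 : ∀ {p y} → Pendant G p → adj G p y ≡ true → 3 ≤ c
  support-deg≥3 {y = y} pp py = subst (3 ≤_) (support-deg pp py) (begin
    3                                         ≤⟨ +-mono-≤ (degG₀≥2 y (support-nonPendant pp py))
                                                          (pendantNeighbour-pos G (adjacent-sym G py) pp) ⟩
    degG₀ G y + count (pendantNeighbour G y)  ≡⟨ deg-split G y ⟨
    deg G y                                   ∎)
    where open ≤-Reasoning

  b-pos : ∀ {p y} → Pendant G p → adj G p y ≡ true → 1 ≤ b
  b-pos {y = y} pp py with nonPendant-neighbour y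
  ... | w , yw , ¬pw = n≢0⇒n>0 λ b≡0 → contradiction (subst (1 ≤_) (no-excess b≡0) excess-pos) λ ()
    where
    excess-pos : 1 ≤ excess G y
    excess-pos = ≤-trans (m<n⇒0<n∸m (nonPendant⇒deg≥2 ¬pw)) (neighbour-excess≤excess G yw)
    no-excess : b ≡ 0 → excess G y ≡ 0
    no-excess b≡0 = trans (sym (+-identityʳ _))
      (subst (λ β → excess G y + β ≡ β * c) b≡0 (support-excess (support-deg pp py)))

  parabola-bounds : ∀ {p y} → Pendant G p → adj G p y ≡ true → b + 4 ≤ c + 1 + b × 5 ≤ c + 1 + b
  parabola-bounds pp py =
    subst (_≤ c + 1 + b) (+-comm 4 b) (+-monoˡ-≤ b (+-monoˡ-≤ 1 c≥3)) ,
    +-mono-≤ (+-monoˡ-≤ 1 c≥3) (b-pos pp py)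
    where
    c≥3 : 3 ≤ c
    c≥3 = support-deg≥3 pp py

lemma9 : ∀ {n : ℕ} (G : Graph n) (a b : ℕ) →
    ConnectedUnicyclic G → MinDegreeOne G → TwoWalkParabolic G a b →
    MinDegG₀≥ G 2 × (b + 4 ≤ a × 5 ≤ a)
lemma9 G a b unicyclic (deg-pos , p , pendant-p) ((_ , _ , parabolic) , _)
  with deg-pos⇒neighbour G (≤-reflexive (sym pendant-p))
... | y , py = degG₀≥2 , subst (λ a → b + 4 ≤ a × 5 ≤ a) (sym a≡) (parabola-bounds pendant-p py)
  where
  a≡ : a ≡ deg G y + 1 + b
  a≡ = parabola-at-pendant G parabolic pendant-p py
  open Parabolic {G = G} {c = deg G y} (unicyclic⇒no-doubleStar G unicyclic) deg-pos (parabola-in-excess-form G parabolic a≡)
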